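{- There exists an order-reversing embedding $\mathcal{E} \hookrightarrow \mathcal{G}$.
   Context: Scott's graph model $\mathcal{G}$ is $\mathcal{P}(\omega)$ with application $A \cdot B = \{n \mid \exists u\, (\langle n,u\rangle \in A \wedge D_u \subseteq B)\}$, $D_u$ the finite set with canonical code $u$ and $\langle\cdot,\cdot\rangle$ a bijective pairing with $\langle 0,0\rangle=0$. $\mathcal{E}$ is the sub-pca of $\mathcal{G}$ consisting of the c.e. sets. An embedding is an injective map $f$ with $f(A)f(B) = f(AB)$ for all $A,B$; it is order-reversing if $A \subseteq B$ implies $f(B) \subseteq f(A)$. -}

module Defs where

open import Data.Nat using (ℕ; zero; suc; _+_; _<_; ⌊_/2⌋)
open import Data.Bool using (Bool; true; false; not)
open import Data.Fin using (Fin)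
open import Data.Vec using (Vec; []; _∷_; lookup)
open import Data.Product using (Σ; _×_; _,_; ∃)
open import Relation.Binary.PropositionalEquality using (_≡_)

Pω : Set₁
Pω = ℕ → Set

_⊆_ : Pω → Pω → Set
A ⊆ B = ∀ n → A n → B n

_≐_ : Pω → Pω → Set
A ≐ B = (A ⊆ B) × (B ⊆ A)

-- Cantor pairing ⟨n,m⟩ = T(n+m) + m, a bijection ℕ×ℕ → ℕ with ⟨0,0⟩ = 0

tri : ℕ → ℕ
tri zero    = zero
tri (suc k) = suc k + tri k

⟨_,_⟩ : ℕ → ℕ → ℕ
⟨ n , m ⟩ = tri (n + m) + m

-- Canonical finite sets: k ∈ D u iff the k-th binary digit of u is 1

odd : ℕ → Bool
odd zero    = false
odd (suc n) = not (odd n)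

bit : ℕ → ℕ → Bool
bit u zero    = odd u
bit u (suc k) = bit ⌊ u /2⌋ k

D : ℕ → Pω
D u k = bit u k ≡ true

_·_ : Pω → Pω → Pω
(A · B) n = Σ ℕ λ u → A ⟨ n , u ⟩ × (D u ⊆ B)

data PR : ℕ → Set where
  zer  : ∀ {k} → PR k
  succ : PR 1
  proj : ∀ {k} → Fin k → PR k
  comp : ∀ {k m} → PR m → Vec (PR k) m → PR k
  prec : ∀ {k} → PR k → PR (suc (suc k)) → PR (suc k)
  mu   : ∀ {k} → PR (suc k) → PR k

mutual
  data _[_]⇓_ : ∀ {k} → PR k → Vec ℕ k → ℕ → Set where
    e-zer  : ∀ {k} {xs : Vec ℕ k} → zer [ xs ]⇓ 0
    e-succ : ∀ {x} → succ [ x ∷ [] ]⇓ suc x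
    e-proj : ∀ {k} {i : Fin k} {xs} → proj i [ xs ]⇓ lookup xs i
    e-comp : ∀ {k m} {f : PR m} {gs : Vec (PR k) m} {xs ys v} →
             gs [ xs ]⇓* ys → f [ ys ]⇓ v → comp f gs [ xs ]⇓ v
    e-prec0 : ∀ {k} {g : PR k} {h} {xs v} →
              g [ xs ]⇓ v → prec g h [ 0 ∷ xs ]⇓ v
    e-precS : ∀ {k} {g : PR k} {h} {n xs r v} →
              prec g h [ n ∷ xs ]⇓ r → h [ n ∷ r ∷ xs ]⇓ v →
              prec g h [ suc n ∷ xs ]⇓ v
    e-mu   : ∀ {k} {f : PR (suc k)} {xs n} →
             f [ n ∷ xs ]⇓ 0 →
             (∀ i → i < n → Σ ℕ λ m → f [ i ∷ xs ]⇓ suc m) →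
             mu f [ xs ]⇓ n

  data _[_]⇓*_ : ∀ {k m} → Vec (PR k) m → Vec ℕ k → Vec ℕ m → Set where
    e-[] : ∀ {k} {xs : Vec ℕ k} → [] [ xs ]⇓* []
    e-∷  : ∀ {k m} {g : PR k} {gs : Vec (PR k) m} {xs y ys} →
           g [ xs ]⇓ y → gs [ xs ]⇓* ys → (g ∷ gs) [ xs ]⇓* (y ∷ ys)

IsCE : Pω → Set
IsCE A = Σ (PR 1) λ f → ∀ n → (A n → ∃ λ v → f [ n ∷ [] ]⇓ v)
                              × ((∃ λ v → f [ n ∷ [] ]⇓ v) → A n)

ℰ : Set₁
ℰ = Σ Pω IsCE

set : ℰ → Pω
set (A , _) = A

record OrderReversingEmbedding (f : ℰ → Pω) : Set₁ where
  field
    -- f is a well-defined map on sets (respects extensional equality,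
    -- hence independent of the c.e. witness)
    respects : ∀ X Y → set X ≐ set Y → f X ≐ f Y
    injective : ∀ X Y → f X ≐ f Y → set X ≐ set Y
    -- f(A) f(B) = f(AB)   (AB is again c.e.; any witness may be used)
    homomorphic : ∀ X Y (XY : ℰ) → set XY ≐ (set X · set Y) →
                  (f X · f Y) ≐ f XY
    order-reversing : ∀ X Y → set X ⊆ set Y → f Y ⊆ f X

-- The embedding sends A to f(A) = { j ∣ A ⊆ W j }, where the family (W j) is defined by
-- recursion on the Cantor code j = ⟨ n , u ⟩: W ⟨ 0 , c + 1 ⟩ is the c.e. set with code c,
-- W 0 and W ⟨ 1 , u ⟩ are ℕ, and for n ≥ 2 (so that n < ⟨ n , u ⟩)
--   W ⟨ n , u ⟩ = { ⟨ a , v ⟩ ∣ D v ⊆ ⋂_{i ∈ D u} W i → a ∈ W n }.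
-- Unfolding this clause, n ∈ f(A) · f(B) says precisely that A B ⊆ W n (for the converse
-- take u the code of { b } for an index b of B). Order reversal is immediate, and f is
-- injective because an index a of A lies in f(A), while a ∈ f(B) means B ⊆ W a = A.
module Submission where

open import Defs
open import Data.Bool using (true)
open import Data.Bool.Properties using (not-involutive)
open import Data.Empty using (⊥-elim)
open import Data.Fin using (Fin; toℕ; fromℕ<)
open import Data.Fin.Properties using (toℕ<n; fromℕ<-toℕ)
open import Data.Nat
open import Data.Nat.Properties
open import Data.Product using (Σ; ∃; _×_; _,_; proj₁; proj₂)
open import Data.Unit using (⊤; tt)
open import Data.Vec using (Vec; []; _∷_)
open import Relation.Binary.PropositionalEquality
open import Relation.Nullary using (¬_; yes; no; contradiction)

≐-sym : ∀ {A B} → A ≐ B → B ≐ A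
≐-sym (A⊆B , B⊆A) = B⊆A , A⊆B

≐-trans : ∀ {A B C} → A ≐ B → B ≐ C → A ≐ C
≐-trans (A⊆B , B⊆A) (B⊆C , C⊆B) = (λ n a → B⊆C n (A⊆B n a)) , (λ n c → B⊆A n (C⊆B n c))

nextPair : ℕ × ℕ → ℕ × ℕ
nextPair (zero  , u) = suc u , 0
nextPair (suc n , u) = n , suc u

unpair : ℕ → ℕ × ℕ
unpair zero    = 0 , 0
unpair (suc x) = nextPair (unpair x)

pair-suc₂ : ∀ n u → ⟨ n , suc u ⟩ ≡ suc ⟨ suc n , u ⟩
pair-suc₂ n u rewrite +-suc n u = +-suc (tri (suc (n + u))) u

pair-suc₁ : ∀ n → ⟨ suc n , 0 ⟩ ≡ suc ⟨ 0 , n ⟩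
pair-suc₁ n rewrite +-identityʳ n | +-identityʳ (n + tri n) = cong suc (+-comm n (tri n))

pair-unpair : ∀ x → ⟨ proj₁ (unpair x) , proj₂ (unpair x) ⟩ ≡ x
pair-unpair zero = refl
pair-unpair (suc x) with unpair x | pair-unpair x
... | zero  , u | eq = trans (pair-suc₁ u) (cong suc eq)
... | suc n , u | eq = trans (pair-suc₂ n u) (cong suc eq)

unpair-pair : ∀ n u → unpair ⟨ n , u ⟩ ≡ (n , u)
unpair-pair n u = along-diagonal (n + u) n u refl
  where
  along-diagonal : ∀ s n u → n + u ≡ s → unpair ⟨ n , u ⟩ ≡ (n , u)
  along-diagonal _       zero    zero    _     = refl
  along-diagonal s       n       (suc u) n+u≡s =
    trans (cong unpair (pair-suc₂ n u))
          (cong nextPair (along-diagonal s (suc n) u (trans (sym (+-suc n u)) n+u≡s)))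
  along-diagonal (suc s) (suc n) zero    n+0≡s =
    trans (cong unpair (pair-suc₁ n))
          (cong nextPair (along-diagonal s zero n (suc-injective n+0≡s′)))
    where n+0≡s′ = trans (cong suc (sym (+-identityʳ n))) n+0≡s

n≤tri[n] : ∀ n → n ≤ tri n
n≤tri[n] zero    = z≤n
n≤tri[n] (suc n) = m≤m+n (suc n) (tri n)

≤-pair₁ : ∀ n u → n ≤ ⟨ n , u ⟩
≤-pair₁ n u = ≤-trans (m≤m+n n u) (≤-trans (n≤tri[n] (n + u)) (m≤m+n (tri (n + u)) u))

≤-pair₂ : ∀ n u → u ≤ ⟨ n , u ⟩
≤-pair₂ n u = m≤n+m u (tri (n + u))

<-pair₂ : ∀ n u → u < ⟨ suc n , u ⟩
<-pair₂ n u = s≤s (m≤n+m u _)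

<-pair₁ : ∀ n u → 2+ n < ⟨ 2+ n , u ⟩
<-pair₁ n u = s≤s (s≤s (m≤n⇒m≤n+o u (≤-<-trans (m≤m+n n u) (m<m+n (n + u) z<s))))

D-zero-empty : ∀ k → ¬ D 0 k
D-zero-empty zero    ()
D-zero-empty (suc k) = D-zero-empty k

D-zero-⊆ : ∀ {A} → D 0 ⊆ A
D-zero-⊆ k k∈D0 = ⊥-elim (D-zero-empty k k∈D0)

D-bound : ∀ u k → D u k → k < u
D-bound zero    k       k∈Du = ⊥-elim (D-zero-empty k k∈Du)
D-bound (suc u) zero    _    = z<s
D-bound (suc u) (suc k) k∈Du = ≤-trans (s≤s (D-bound ⌊ suc u /2⌋ k k∈Du)) (⌊n/2⌋<n u)

singletonCode : ℕ → ℕ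
singletonCode zero    = 1
singletonCode (suc k) = singletonCode k + singletonCode k

even-double : ∀ n → ¬ odd (n + n) ≡ true
even-double zero    ()
even-double (suc n) rewrite +-suc n n | not-involutive (odd (n + n)) = even-double n

D-singletonCode-self : ∀ k → D (singletonCode k) k
D-singletonCode-self zero    = refl
D-singletonCode-self (suc k) rewrite sym (n≡⌊n+n/2⌋ (singletonCode k)) = D-singletonCode-self k

D-singletonCode : ∀ k i → D (singletonCode k) i → i ≡ k
D-singletonCode zero    zero    _    = refl
D-singletonCode zero    (suc i) i∈Dk = ⊥-elim (D-zero-empty i i∈Dk)
D-singletonCode (suc k) zero    i∈Dk = ⊥-elim (even-double (singletonCode k) i∈Dk)
D-singletonCode (suc k) (suc i) i∈Dk rewrite sym (n≡⌊n+n/2⌋ (singletonCode k)) =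
  cong suc (D-singletonCode k i i∈Dk)

⋂ : (ℕ → Pω) → ℕ → Pω
⋂ R u k = ∀ i → D u i → R i k

module Tower (Base : ℕ → Pω) where

  Step : (ℕ → Pω) → ℕ → ℕ → Pω
  Step R 0      0       _ = ⊤
  Step R 0      (suc c)   = Base c
  Step R 1      _       _ = ⊤
  Step R (2+ n) u       m = ∀ a v → m ≡ ⟨ a , v ⟩ → D v ⊆ ⋂ R u → R (2+ n) a

  Step-⊆ : ∀ n u {R R′} → (∀ i → i < ⟨ n , u ⟩ → R i ≐ R′ i) → Step R n u ⊆ Step R′ n u
  Step-⊆ 0      0       _  _ x = x
  Step-⊆ 0      (suc c) _  _ x = x
  Step-⊆ 1      _       _  _ x = x
  Step-⊆ (2+ n) u       R≐R′ m m∈Step a v m≡av Dv⊆⋂R′ =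
    proj₁ (R≐R′ (2+ n) (<-pair₁ n u)) a
      (m∈Step a v m≡av λ k k∈Dv i i∈Du →
        proj₂ (R≐R′ i (<-≤-trans (D-bound u i i∈Du) (≤-pair₂ (2+ n) u))) k (Dv⊆⋂R′ k k∈Dv i i∈Du))

  Step-cong : ∀ n u {R R′} → (∀ i → i < ⟨ n , u ⟩ → R i ≐ R′ i) → Step R n u ≐ Step R′ n u
  Step-cong n u R≐R′ = Step-⊆ n u R≐R′ , Step-⊆ n u (λ i i< → ≐-sym (R≐R′ i i<))

  -- W j is computed with fuel; Step at ⟨ n , u ⟩ only consults indices below ⟨ n , u ⟩,
  -- so any fuel above j gives the same set.
  Wf : ℕ → ℕ → Pω
  Wf zero    _ _ = ⊤
  Wf (suc s) j   = Step (Wf s) (proj₁ (unpair j)) (proj₂ (unpair j))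

  Wf-stable : ∀ s t j → j < s → j < t → Wf s j ≐ Wf t j
  Wf-stable (suc s) (suc t) j (s≤s j≤s) (s≤s j≤t) =
    Step-cong (proj₁ (unpair j)) (proj₂ (unpair j)) λ i i< →
      let i<j = subst (i <_) (pair-unpair j) i< in
      Wf-stable s t i (<-≤-trans i<j j≤s) (<-≤-trans i<j j≤t)

  W : ℕ → Pω
  W j = Wf (suc j) j

  W-unfold : ∀ n u → W ⟨ n , u ⟩ ≐ Step W n u
  W-unfold n u rewrite unpair-pair n u =
    Step-cong n u λ i i< → Wf-stable ⟨ n , u ⟩ (suc i) i i< (n<1+n i)

  W-base : ∀ c → W ⟨ 0 , suc c ⟩ ≐ Base c
  W-base c = W-unfold 0 (suc c)

  Indexed : Pω → Set
  Indexed A = ∃ λ a → W a ≐ A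

  indicesAbove : Pω → Pω
  indicesAbove A j = A ⊆ W j

  indicesAbove-antitone : ∀ {A B} → A ⊆ B → indicesAbove B ⊆ indicesAbove A
  indicesAbove-antitone A⊆B j B⊆Wj n a = B⊆Wj n (A⊆B n a)

  indicesAbove-cong : ∀ {A B} → A ≐ B → indicesAbove A ≐ indicesAbove B
  indicesAbove-cong (A⊆B , B⊆A) = indicesAbove-antitone B⊆A , indicesAbove-antitone A⊆B

  indicesAbove-reflects-⊆ : ∀ {A B} → Indexed A → indicesAbove A ⊆ indicesAbove B → B ⊆ A
  indicesAbove-reflects-⊆ (a , Wa≐A) fA⊆fB n b = proj₁ Wa≐A n (fA⊆fB a (proj₂ Wa≐A) n b)

  indicesAbove-injective : ∀ {A B} → Indexed A → Indexed B →
                           indicesAbove A ≐ indicesAbove B → A ≐ B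
  indicesAbove-injective iA iB (fA⊆fB , fB⊆fA) =
    indicesAbove-reflects-⊆ iB fB⊆fA , indicesAbove-reflects-⊆ iA fA⊆fB

  ·-indicesAbove-⊆ : ∀ {A B} → (indicesAbove A · indicesAbove B) ⊆ indicesAbove (A · B)
  ·-indicesAbove-⊆ 0      _                       _ _ = tt
  ·-indicesAbove-⊆ 1      _                       _ _ = tt
  ·-indicesAbove-⊆ (2+ n) (u , A⊆Wnu , Du⊆fB) m (v , A⟨m,v⟩ , Dv⊆B) =
    proj₁ (W-unfold (2+ n) u) ⟨ m , v ⟩ (A⊆Wnu _ A⟨m,v⟩) m v refl
      λ k k∈Dv i i∈Du → Du⊆fB i i∈Du k (Dv⊆B k k∈Dv)

  indicesAbove-·-⊆ : ∀ {A B} → Indexed B → indicesAbove (A · B) ⊆ (indicesAbove A · indicesAbove B)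
  indicesAbove-·-⊆ _ 0 _ = 0 , (λ _ _ → tt) , D-zero-⊆
  indicesAbove-·-⊆ _ 1 _ = 0 , (λ _ _ → tt) , D-zero-⊆
  indicesAbove-·-⊆ {A} {B} (b , Wb≐B) (2+ n) AB⊆Wn = singletonCode b , A⊆Wnu , Du⊆fB
    where
    A⊆Wnu : A ⊆ W ⟨ 2+ n , singletonCode b ⟩
    A⊆Wnu m Am = proj₂ (W-unfold (2+ n) (singletonCode b)) m λ a v m≡av Dv⊆⋂W →
      AB⊆Wn a (v , subst A m≡av Am , λ k k∈Dv →
        proj₁ Wb≐B k (Dv⊆⋂W k k∈Dv b (D-singletonCode-self b)))

    Du⊆fB : D (singletonCode b) ⊆ indicesAbove B
    Du⊆fB i i∈Du rewrite D-singletonCode b i i∈Du = proj₂ Wb≐B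

  indicesAbove-· : ∀ {A B} → Indexed B → (indicesAbove A · indicesAbove B) ≐ indicesAbove (A · B)
  indicesAbove-· iB = ·-indicesAbove-⊆ , indicesAbove-·-⊆ iB

mutual
  code : ∀ {k} → PR k → ℕ
  code zer                 = ⟨ 0 , 0 ⟩
  code succ                = ⟨ 1 , 0 ⟩
  code (proj i)            = ⟨ 2 , toℕ i ⟩
  code (comp {m = m} f gs) = ⟨ 3 , ⟨ m , ⟨ code f , codes gs ⟩ ⟩ ⟩
  code (prec g h)          = ⟨ 4 , ⟨ code g , code h ⟩ ⟩
  code (mu f)              = ⟨ 5 , code f ⟩

  codes : ∀ {k m} → Vec (PR k) m → ℕ
  codes []       = 0
  codes (g ∷ gs) = ⟨ code g , codes gs ⟩

decodeProj : (k i : ℕ) → PR k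
decodeProj k i with i <? k
... | yes i<k = proj (fromℕ< i<k)
... | no  _   = zer

decodeProj-toℕ : ∀ {k} (i : Fin k) → decodeProj k (toℕ i) ≡ proj i
decodeProj-toℕ {k} i with toℕ i <? k
... | yes i<k = cong proj (fromℕ<-toℕ i i<k)
... | no  i≮k = contradiction (toℕ<n i) i≮k

-- decode s k c reads c as a code of arity k using fuel s; ill-formed codes and
-- exhausted fuel yield zer.
mutual
  decode : ℕ → (k : ℕ) → ℕ → PR k
  decode zero    k c = zer
  decode (suc s) k c = decodeTagged s (unpair c) k

  decodeTagged : ℕ → ℕ × ℕ → (k : ℕ) → PR k
  decodeTagged s (1 , _) 1       = succ
  decodeTagged s (2 , i) k       = decodeProj k i
  decodeTagged s (3 , x) k       =
    let m , y = unpair x ; a , b = unpair y in comp (decode s m a) (decodes s k m b)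
  decodeTagged s (4 , x) (suc k) =
    let a , b = unpair x in prec (decode s k a) (decode s (2+ k) b)
  decodeTagged s (5 , x) k       = mu (decode s (suc k) x)
  decodeTagged s _       k       = zer

  decodes : ℕ → (k m : ℕ) → ℕ → Vec (PR k) m
  decodes s k zero    c = []
  decodes s k (suc m) c = let a , b = unpair c in decode s k a ∷ decodes s k m b

<-tagged : ∀ {t x s} → ⟨ suc t , x ⟩ < suc s → x < s
<-tagged {t} {x} (s≤s lt) = <-≤-trans (<-pair₂ t x) lt

<-pair₁-< : ∀ a b {s} → ⟨ a , b ⟩ < s → a < s
<-pair₁-< a b = ≤-<-trans (≤-pair₁ a b)

<-pair₂-< : ∀ a b {s} → ⟨ a , b ⟩ < s → b < s
<-pair₂-< a b = ≤-<-trans (≤-pair₂ a b)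

mutual
  decode-code : ∀ {k} s (f : PR k) → code f < s → decode s k (code f) ≡ f
  decode-code (suc s) zer      _ = refl
  decode-code (suc s) succ     _ = refl
  decode-code (suc s) (proj i) _ rewrite unpair-pair 2 (toℕ i) = decodeProj-toℕ i
  decode-code (suc s) (comp {m = m} f gs) lt
    rewrite unpair-pair 3 ⟨ m , ⟨ code f , codes gs ⟩ ⟩
          | unpair-pair m ⟨ code f , codes gs ⟩
          | unpair-pair (code f) (codes gs) =
    cong₂ comp (decode-code s f (<-pair₁-< (code f) (codes gs) args<s))
               (decodes-codes s gs (<-pair₂-< (code f) (codes gs) args<s))
    where args<s = <-pair₂-< m ⟨ code f , codes gs ⟩ (<-tagged {2} lt)
  decode-code (suc s) (prec g h) lt
    rewrite unpair-pair 4 ⟨ code g , code h ⟩ | unpair-pair (code g) (code h) =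
    cong₂ prec (decode-code s g (<-pair₁-< (code g) (code h) args<s))
               (decode-code s h (<-pair₂-< (code g) (code h) args<s))
    where args<s = <-tagged {3} lt
  decode-code (suc s) (mu f) lt rewrite unpair-pair 5 (code f) =
    cong mu (decode-code s f (<-tagged {4} lt))

  decodes-codes : ∀ {k m} s (gs : Vec (PR k) m) → codes gs < s → decodes s k m (codes gs) ≡ gs
  decodes-codes s []       _  = refl
  decodes-codes s (g ∷ gs) lt rewrite unpair-pair (code g) (codes gs) =
    cong₂ _∷_ (decode-code s g (<-pair₁-< (code g) (codes gs) lt))
              (decodes-codes s gs (<-pair₂-< (code g) (codes gs) lt))

dom : PR 1 → Pω
dom f n = ∃ λ v → f [ n ∷ [] ]⇓ v

programDomain : ℕ → Pω
programDomain c = dom (decode (suc c) 1 c)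

programDomain-code : ∀ f → programDomain (code f) ≡ dom f
programDomain-code f = cong dom (decode-code (suc (code f)) f (n<1+n (code f)))

open Tower programDomain

CE-indexed : ∀ {A} → IsCE A → Indexed A
CE-indexed {A} (f , spec) = ⟨ 0 , suc (code f) ⟩ ,
  ≐-trans (W-base (code f))
          (subst (_≐ A) (sym (programDomain-code f)) ((λ n → proj₂ (spec n)) , (λ n → proj₁ (spec n))))

theorem7p12 : Σ (ℰ → Pω) OrderReversingEmbedding
theorem7p12 = (λ X → indicesAbove (set X)) , record
  { respects        = λ _ _ → indicesAbove-cong
  ; injective       = λ (_ , ceX) (_ , ceY) → indicesAbove-injective (CE-indexed ceX) (CE-indexed ceY)
  ; homomorphic     = λ _ (_ , ceY) _ XY≐X·Y →
      ≐-trans (indicesAbove-· (CE-indexed ceY)) (indicesAbove-cong (≐-sym XY≐X·Y))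
  ; order-reversing = λ _ _ → indicesAbove-antitone
  }
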